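{- If there is a $(k,q,a,d)$-blurer $\Xi$, then (1) there is a $(k,q,a,d')$-blurer for every $d'\ge d$; (2) $\Xi$ is a $(k',q,a,d)$-blurer for every $k'\le k$; and (3) there is a $(k,q,c\cdot a,d)$-blurer for every $c\in\mathbb{Z}_{2^q}$.
   Context: For $\Xi\subseteq\mathbb{Z}_{2^q}^d$, $N\subseteq[d]$, $\bar b\in\mathbb{Z}_{2^q}^{|N|}$ let $\#_{N,\bar b}(\Xi)=|\{\bar c\in\Xi:\bar c|_N=\bar b\}|\bmod2$, where $\bar c|_N$ is the restriction to indices in $N$ (in increasing order). For $d\ge k$ and $a\in\mathbb{Z}_{2^q}$, $\Xi$ is a $(k,q,a,d)$-blurer if for all $N\subseteq[d]$ with $|N|=k$: (1) $\sum_j\xi(j)=0$ for all $\xi\in\Xi$; (2) if $1\in N$ then $\#_{N,(a,0,\dots,0)}(\Xi)=1$; (3) if $1\notin N$ then $\#_{N,\bar0}(\Xi)=1$; (4) $\#_{N,\bar b}(\Xi)=0$ for all other pairs $N,\bar b$. -}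

module Defs where

open import Data.Bool using (Bool; true; false; if_then_else_)
open import Data.Nat using (ℕ; zero; suc; _+_; _*_; _^_; _∸_; _≤_; NonZero)
open import Data.Nat.Properties using (m^n≢0)
open import Data.Nat.DivMod using (_mod_; _%_)
open import Data.Fin as Fin using (Fin; toℕ)
import Data.Fin.Properties as FinP
open import Data.Fin.Subset using (Subset; ∣_∣)
open import Data.Vec using (Vec; []; _∷_; toList)
open import Data.List as List using (List; []; _∷_; length; filter; replicate; map)
open import Data.Nat.ListAction using (sum)
import Data.List.Properties as ListP
open import Data.List.Relation.Unary.Unique.Propositional using (Unique)
open import Data.List.Membership.Propositional using (_∈_)
open import Relation.Binary.PropositionalEquality using (_≡_; _≢_)

Zq : ℕ → Set
Zq q = Fin (2 ^ q)

private
  nz : (q : ℕ) → NonZero (2 ^ q)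
  nz q = m^n≢0 2 q

⟦_⟧ : (q : ℕ) → ℕ → Zq q
⟦ q ⟧ n = _mod_ n (2 ^ q) {{nz q}}

0q : (q : ℕ) → Zq q
0q q = ⟦ q ⟧ 0

mulq : (q : ℕ) → Zq q → Zq q → Zq q
mulq q x y = ⟦ q ⟧ (toℕ x * toℕ y)

sumq : (q : ℕ) {d : ℕ} → Vec (Zq q) d → Zq q
sumq q v = ⟦ q ⟧ (sum (map toℕ (toList v)))

restrict : {A : Set} {d : ℕ} → Subset d → Vec A d → List A
restrict []          []       = []
restrict (true ∷ N)  (x ∷ xs) = x ∷ restrict N xs
restrict (false ∷ N) (x ∷ xs) = restrict N xs

-- does N contain the first index (index "1" of the paper)?
firstIn : {d : ℕ} → Subset d → Bool
firstIn []      = false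
firstIn (b ∷ _) = b

count# : (q : ℕ) {d : ℕ} → Subset d → List (Zq q) → List (Vec (Zq q) d) → ℕ
count# q N b Ξ =
  length (filter (λ c → ListP.≡-dec FinP._≟_ (restrict N c) b) Ξ) % 2

target : (q : ℕ) {d : ℕ} → (k : ℕ) → Zq q → Subset d → List (Zq q)
target q k a N =
  if firstIn N then a ∷ replicate (k ∸ 1) (0q q) else replicate k (0q q)

record IsBlurer (k q : ℕ) (a : Zq q) (d : ℕ) (Ξ : List (Vec (Zq q) d)) : Set where
  field
    isSet    : Unique Ξ
    k≤d      : k ≤ d
    zeroSum  : ∀ ξ → ξ ∈ Ξ → sumq q ξ ≡ 0q q
    cond1∈N  : (N : Subset d) → ∣ N ∣ ≡ k → firstIn N ≡ true →
               count# q N (a ∷ replicate (k ∸ 1) (0q q)) Ξ ≡ 1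
    cond1∉N  : (N : Subset d) → ∣ N ∣ ≡ k → firstIn N ≡ false →
               count# q N (replicate k (0q q)) Ξ ≡ 1
    condRest : (N : Subset d) → ∣ N ∣ ≡ k → (b : Vec (Zq q) k) →
               toList b ≢ target q k a N → count# q N (toList b) Ξ ≡ 0

{-# OPTIONS --safe #-}
module Submission where

-- Read modulo 2, the blurer conditions say that for every k-set N of coordinates
-- the multiset {ξ|_N : ξ ∈ Ξ} has odd multiplicity exactly at the target tuple,
-- which is the restriction of a·e₁ = (a, 0, …, 0).  Hence, for every predicate
-- depending only on the coordinates in N (and, after enlarging N, in any set of at
-- most k coordinates) the number of ξ ∈ Ξ satisfying it has the parity of its
-- value at a·e₁.  All three claims are instances: (2) is the case of smaller N;
-- for (1) pad every vector with zeros, so a condition on the padded vector only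
-- looks at the original coordinates of N; for (3) multiply every vector by c,
-- which sends a·e₁ to (c a)·e₁, and cancel coinciding vectors in pairs to obtain
-- a set again.

open import Defs
open import Data.Bool using (true; false; if_then_else_)
open import Data.Empty using (⊥-elim)
open import Data.Fin using (Fin; toℕ)
import Data.Fin.Properties as FinP
open import Data.Fin.Subset using (Subset; ∣_∣)
open import Data.List as List using (List; []; _∷_; length; filter; replicate)
import Data.List.Properties as ListP
open import Data.List.Membership.Propositional using (_∈_)
open import Data.List.Membership.Propositional.Properties using (∈-map⁻)
open import Data.List.Relation.Unary.All as All using ([]; _∷_)
open import Data.List.Relation.Unary.Any as Any using (here; there)
open import Data.List.Relation.Unary.AllPairs using ([]; _∷_)
open import Data.List.Relation.Unary.Unique.Propositional using (Unique)
import Data.List.Relation.Unary.Unique.Propositional.Properties as Unique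
open import Data.Nat
  using (ℕ; zero; suc; _+_; _*_; _^_; _∸_; _≤_; _%_; z≤n; s≤s; s≤s⁻¹; NonZero)
  renaming (_≟_ to _≟ℕ_)
open import Data.Nat.DivMod using (%-distribˡ-+; %-distribˡ-*; m%n%n≡m%n; [m+kn]%n≡m%n; m*n%n≡0)
open import Data.Nat.ListAction using (sum)
open import Data.Nat.ListAction.Properties using (sum-++)
open import Data.Nat.Properties
  using (≤-antisym; ≤-reflexive; ≤-trans; m≤m+n; m≤n⇒∃[o]m+o≡n; m∸n+n≡m; m^n≢0; +-suc; +-identityʳ; *-zeroʳ;
         *-distribˡ-+)
open import Data.Nat.Tactic.RingSolver using (solve-∀)
open import Data.Product using (Σ; Σ-syntax; _×_; _,_)
open import Data.Vec as Vec using (Vec; []; _∷_; toList)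
import Data.Vec.Properties as VecP
open import Function using (_∘_)
open import Relation.Binary using (DecidableEquality)
open import Relation.Binary.PropositionalEquality
open import Relation.Nullary using (Dec; yes; no; does; ¬_)
open import Relation.Unary using (Decidable)

open ≡-Reasoning

count : {A : Set} {P : A → Set} → Decidable P → List A → ℕ
count P? xs = length (filter P? xs)

indicator : {P : Set} → Dec P → ℕ
indicator P? = if does P? then 1 else 0

module _ {P : Set} where

  indicator-true : (P? : Dec P) → P → indicator P? ≡ 1
  indicator-true (yes _) _ = refl
  indicator-true (no ¬p) p = ⊥-elim (¬p p)

  indicator-false : (P? : Dec P) → ¬ P → indicator P? ≡ 0
  indicator-false (yes p) ¬p = ⊥-elim (¬p p)
  indicator-false (no _)  _  = refl

  indicator-sound : (P? : Dec P) → indicator P? ≡ 1 → P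
  indicator-sound (yes p) _ = p
  indicator-sound (no _)  ()

module _ {A : Set} {P : A → Set} (P? : Decidable P) where

  count-∷ : ∀ x xs → count P? (x ∷ xs) ≡ indicator (P? x) + count P? xs
  count-∷ x xs with does (P? x)
  ... | true  = refl
  ... | false = refl

  count-[-]-%2 : ∀ x → count P? (x ∷ []) % 2 ≡ indicator (P? x)
  count-[-]-%2 x with does (P? x)
  ... | true  = refl
  ... | false = refl

  count-map : {B : Set} (f : B → A) (xs : List B) → count P? (List.map f xs) ≡ count (P? ∘ f) xs
  count-map f []       = refl
  count-map f (x ∷ xs) with does (P? (f x))
  ... | true  = cong suc (count-map f xs)
  ... | false = count-map f xs

  count-∘-cong : {B : Set} {f g : B → A} → (∀ x → f x ≡ g x) → ∀ xs →
                 count (P? ∘ f) xs ≡ count (P? ∘ g) xs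
  count-∘-cong f≗g xs =
    cong length (ListP.filter-≐ (P? ∘ _) (P? ∘ _) ((λ {x} → subst P (f≗g x)) , (λ {x} → subst P (sym (f≗g x)))) xs)

+-%-congʳ : ∀ i {m n d} .{{_ : NonZero d}} → m % d ≡ n % d → (i + m) % d ≡ (i + n) % d
+-%-congʳ i {m} {n} {d} m≡n = begin
  (i + m) % d             ≡⟨ %-distribˡ-+ i m d ⟩
  (i % d + m % d) % d     ≡⟨ cong (λ r → (i % d + r) % d) m≡n ⟩
  (i % d + n % d) % d     ≡⟨ %-distribˡ-+ i n d ⟨
  (i + n) % d             ∎

*-%-congʳ : ∀ m n d .{{_ : NonZero d}} → (m * n) % d ≡ (m * (n % d)) % d
*-%-congʳ m n d = begin
  (m * n) % d                   ≡⟨ %-distribˡ-* m n d ⟩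
  (m % d * (n % d)) % d         ≡⟨ cong (λ r → (m % d * r) % d) (m%n%n≡m%n n d) ⟨
  (m % d * (n % d % d)) % d     ≡⟨ %-distribˡ-* m (n % d) d ⟨
  (m * (n % d)) % d             ∎

-- oddPart xs keeps one copy of every element occurring an odd number of times in xs.
module OddPart {A : Set} (_≟_ : DecidableEquality A) where

  toggle : A → List A → List A
  toggle x []      = x ∷ []
  toggle x (y ∷ M) with x ≟ y
  ... | yes _ = M
  ... | no  _ = y ∷ toggle x M

  oddPart : List A → List A
  oddPart = List.foldr toggle []

  ∈-toggle⁻ : ∀ {x z} M → z ∈ toggle x M → z ∈ x ∷ M
  ∈-toggle⁻ []          z∈ = z∈
  ∈-toggle⁻ {x} (y ∷ M) z∈ with x ≟ y
  ... | yes _ = there (there z∈)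
  ∈-toggle⁻ (y ∷ M) (here z≡y)  | no _ = there (here z≡y)
  ∈-toggle⁻ (y ∷ M) (there z∈′) | no _ with ∈-toggle⁻ M z∈′
  ... | here z≡x  = here z≡x
  ... | there z∈M = there (there z∈M)

  ∈-oddPart⁻ : ∀ {z} xs → z ∈ oddPart xs → z ∈ xs
  ∈-oddPart⁻ (x ∷ xs) z∈ with ∈-toggle⁻ (oddPart xs) z∈
  ... | here z≡x  = here z≡x
  ... | there z∈′ = there (∈-oddPart⁻ xs z∈′)

  toggle-Unique : ∀ x {M} → Unique M → Unique (toggle x M)
  toggle-Unique x {[]}    []          = [] ∷ []
  toggle-Unique x {y ∷ M} (y∉M ∷ uM) with x ≟ y
  ... | yes _   = uM
  ... | no  x≢y = All.tabulate y≢ ∷ toggle-Unique x uM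
    where
    y≢ : ∀ {z} → z ∈ toggle x M → y ≢ z
    y≢ z∈ y≡z with ∈-toggle⁻ M z∈
    ... | here z≡x  = x≢y (sym (trans y≡z z≡x))
    ... | there z∈M = All.lookup y∉M z∈M y≡z

  oddPart-Unique : ∀ xs → Unique (oddPart xs)
  oddPart-Unique []       = []
  oddPart-Unique (x ∷ xs) = toggle-Unique x (oddPart-Unique xs)

  module _ {P : A → Set} (P? : Decidable P) where

    count-toggle : ∀ x M → count P? (toggle x M) % 2 ≡ count P? (x ∷ M) % 2
    count-toggle x []      = refl
    count-toggle x (y ∷ M) with x ≟ y
    ... | yes refl = begin
      count P? M % 2                                 ≡⟨ [m+kn]%n≡m%n (count P? M) i 2 ⟨
      (count P? M + i * 2) % 2                       ≡⟨ cong (_% 2) (double i (count P? M)) ⟨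
      (i + (i + count P? M)) % 2                     ≡⟨ cong (λ r → (i + r) % 2) (count-∷ P? x M) ⟨
      (i + count P? (x ∷ M)) % 2                     ≡⟨ cong (_% 2) (count-∷ P? x (x ∷ M)) ⟨
      count P? (x ∷ x ∷ M) % 2                       ∎
      where
      i = indicator (P? x)
      double : ∀ i c → i + (i + c) ≡ c + i * 2
      double = solve-∀
    ... | no _ = begin
      count P? (y ∷ toggle x M) % 2                  ≡⟨ cong (_% 2) (count-∷ P? y (toggle x M)) ⟩
      (iy + count P? (toggle x M)) % 2               ≡⟨ +-%-congʳ iy (count-toggle x M) ⟩
      (iy + count P? (x ∷ M)) % 2                    ≡⟨ cong (λ r → (iy + r) % 2) (count-∷ P? x M) ⟩
      (iy + (ix + count P? M)) % 2                   ≡⟨ cong (_% 2) (swap iy ix (count P? M)) ⟩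
      (ix + (iy + count P? M)) % 2                   ≡⟨ cong (λ r → (ix + r) % 2) (count-∷ P? y M) ⟨
      (ix + count P? (y ∷ M)) % 2                    ≡⟨ cong (_% 2) (count-∷ P? x (y ∷ M)) ⟨
      count P? (x ∷ y ∷ M) % 2                       ∎
      where
      ix = indicator (P? x)
      iy = indicator (P? y)
      swap : ∀ m n o → m + (n + o) ≡ n + (m + o)
      swap = solve-∀

    count-oddPart : ∀ xs → count P? (oddPart xs) % 2 ≡ count P? xs % 2
    count-oddPart []       = refl
    count-oddPart (x ∷ xs) = begin
      count P? (toggle x (oddPart xs)) % 2           ≡⟨ count-toggle x (oddPart xs) ⟩
      count P? (x ∷ oddPart xs) % 2                  ≡⟨ cong (_% 2) (count-∷ P? x (oddPart xs)) ⟩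
      (indicator (P? x) + count P? (oddPart xs)) % 2 ≡⟨ +-%-congʳ (indicator (P? x)) (count-oddPart xs) ⟩
      (indicator (P? x) + count P? xs) % 2           ≡⟨ cong (_% 2) (count-∷ P? x xs) ⟨
      count P? (x ∷ xs) % 2                          ∎

  count-≟-Unique : ∀ z {M} → Unique M → count (_≟ z) M ≤ 1
  count-≟-Unique z {[]}    []          = z≤n
  count-≟-Unique z {y ∷ M} (y∉M ∷ uM) with y ≟ z
  ... | yes refl = s≤s (≤-reflexive (cong length
                     (ListP.filter-none (_≟ y) (All.map (λ y≢w w≡y → y≢w (sym w≡y)) y∉M))))
  ... | no  _    = count-≟-Unique z uM

  count-≟≢0⇒∈ : ∀ z M → count (_≟ z) M ≢ 0 → z ∈ M
  count-≟≢0⇒∈ z []      c≢0 = ⊥-elim (c≢0 refl)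
  count-≟≢0⇒∈ z (y ∷ M) c≢0 with y ≟ z
  ... | yes y≡z = here (sym y≡z)
  ... | no  _   = there (count-≟≢0⇒∈ z M c≢0)

  Unique-singleton : ∀ {t : A} {M : List A} → Unique M → t ∈ M → (∀ {z} → z ∈ M → z ≡ t) → M ≡ t ∷ []
  Unique-singleton {M = y ∷ []}    _                  _ ≡t = cong (_∷ []) (≡t (here refl))
  Unique-singleton {M = y ∷ w ∷ M} ((y≢w ∷ _) ∷ _)   _ ≡t =
    ⊥-elim (y≢w (trans (≡t (here refl)) (sym (≡t (there (here refl))))))

  count-%2-singleton : ∀ t xs → (∀ z → count (_≟ z) xs % 2 ≡ indicator (t ≟ z)) →
                       {P : A → Set} (P? : Decidable P) → count P? xs % 2 ≡ indicator (P? t)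
  count-%2-singleton t xs parity P? = begin
    count P? xs % 2          ≡⟨ count-oddPart P? xs ⟨
    count P? M % 2           ≡⟨ cong (λ L → count P? L % 2) M≡[t] ⟩
    count P? (t ∷ []) % 2    ≡⟨ count-[-]-%2 P? t ⟩
    indicator (P? t)         ∎
    where
    M  = oddPart xs
    uM = oddPart-Unique xs

    parity-M : ∀ z → count (_≟ z) M % 2 ≡ indicator (t ≟ z)
    parity-M z = trans (count-oddPart (_≟ z) xs) (parity z)

    t∈M : t ∈ M
    t∈M = count-≟≢0⇒∈ t M λ c≡0 → 0≢1 (trans (cong (_% 2) (sym c≡0))
                                              (trans (parity-M t) (indicator-true (t ≟ t) refl)))
      where
      0≢1 : 0 ≢ 1
      0≢1 ()

    ∈M⇒≡t : ∀ {z} → z ∈ M → z ≡ t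
    ∈M⇒≡t {z} z∈M = sym (indicator-sound (t ≟ z) (trans (sym (parity-M z)) (cong (_% 2) c≡1)))
      where
      c≡1 : count (_≟ z) M ≡ 1
      c≡1 = ≤-antisym (count-≟-Unique z uM) (ListP.filter-some (_≟ z) (Any.map sym z∈M))

    M≡[t] : M ≡ t ∷ []
    M≡[t] = Unique-singleton uM t∈M ∈M⇒≡t

module _ {A : Set} where

  length-restrict : ∀ {d} (N : Subset d) (ξ : Vec A d) → length (restrict N ξ) ≡ ∣ N ∣
  length-restrict []          []       = refl
  length-restrict (true ∷ N)  (x ∷ ξ) = cong suc (length-restrict N ξ)
  length-restrict (false ∷ N) (x ∷ ξ) = length-restrict N ξ

  restrict-replicate : ∀ {d} (N : Subset d) (x : A) → restrict N (Vec.replicate d x) ≡ replicate ∣ N ∣ x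
  restrict-replicate []          x = refl
  restrict-replicate (true ∷ N)  x = cong (x ∷_) (restrict-replicate N x)
  restrict-replicate (false ∷ N) x = restrict-replicate N x

  restrict-map : ∀ {B : Set} {d} (f : A → B) (N : Subset d) (ξ : Vec A d) →
                 restrict N (Vec.map f ξ) ≡ List.map f (restrict N ξ)
  restrict-map f []          []       = refl
  restrict-map f (true ∷ N)  (x ∷ ξ) = cong (f x ∷_) (restrict-map f N ξ)
  restrict-map f (false ∷ N) (x ∷ ξ) = restrict-map f N ξ

  restrict-++ : ∀ d {e} (N : Subset (d + e)) (ξ : Vec A d) (ζ : Vec A e) →
                restrict N (ξ Vec.++ ζ) ≡ restrict (Vec.take d N) ξ List.++ restrict (Vec.drop d N) ζ
  restrict-++ zero    N           []       ζ = refl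
  restrict-++ (suc d) (true ∷ N)  (x ∷ ξ) ζ = cong (x ∷_) (restrict-++ d N ξ ζ)
  restrict-++ (suc d) (false ∷ N) (x ∷ ξ) ζ = restrict-++ d N ξ ζ

  enlarge : ∀ {d} (N : Subset d) (j : ℕ) → j + ∣ N ∣ ≤ d →
            Σ[ N⁺ ∈ Subset d ] ∣ N⁺ ∣ ≡ j + ∣ N ∣ ×
              Σ[ h ∈ (List A → List A) ] (∀ ξ → h (restrict N⁺ ξ) ≡ restrict N ξ)
  enlarge []          zero    _ = [] , refl , (λ l → l) , λ { [] → refl }
  enlarge {suc d} (true ∷ N) j j+∣N∣≤d with enlarge N j (s≤s⁻¹ (subst (_≤ suc d) (+-suc j ∣ N ∣) j+∣N∣≤d))
  ... | N⁺ , ∣N⁺∣≡ , h , h-restrict =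
    true ∷ N⁺ , trans (cong suc ∣N⁺∣≡) (sym (+-suc j ∣ N ∣)) ,
    (λ l → List.take 1 l List.++ h (List.drop 1 l)) , λ { (x ∷ ξ) → cong (x ∷_) (h-restrict ξ) }
  enlarge (false ∷ N) zero    _ = false ∷ N , refl , (λ l → l) , λ _ → refl
  enlarge (false ∷ N) (suc j) j+∣N∣≤d with enlarge N j (s≤s⁻¹ j+∣N∣≤d)
  ... | N⁺ , ∣N⁺∣≡ , h , h-restrict = true ∷ N⁺ , cong suc ∣N⁺∣≡ , h ∘ List.drop 1 , λ { (x ∷ ξ) → h-restrict ξ }

∣take∣≤∣∣ : ∀ d {e} (N : Subset (d + e)) → ∣ Vec.take d N ∣ ≤ ∣ N ∣
∣take∣≤∣∣ zero    N           = z≤n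
∣take∣≤∣∣ (suc d) (true ∷ N)  = s≤s (∣take∣≤∣∣ d N)
∣take∣≤∣∣ (suc d) (false ∷ N) = ∣take∣≤∣∣ d N

∣∣≡0⇒firstIn≡false : ∀ {d} (N : Subset d) → ∣ N ∣ ≡ 0 → firstIn N ≡ false
∣∣≡0⇒firstIn≡false []          _ = refl
∣∣≡0⇒firstIn≡false (false ∷ N) _ = refl

vecOfLength : {A : Set} {k : ℕ} (l : List A) → length l ≡ k → Σ[ v ∈ Vec A k ] toList v ≡ l
vecOfLength l refl = Vec.fromList l , VecP.toList∘fromList l

-- The equality test used inside count#, so that count# q N b Ξ is count ((_≟ₗ b) ∘ restrict N) Ξ % 2.
_≟ₗ_ : {n : ℕ} → DecidableEquality (List (Fin n))
_≟ₗ_ = ListP.≡-dec FinP._≟_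

scale : (q : ℕ) {d : ℕ} → Zq q → Vec (Zq q) d → Vec (Zq q) d
scale q c = Vec.map (mulq q c)

pad : (q : ℕ) {d : ℕ} (e : ℕ) → Vec (Zq q) d → Vec (Zq q) (d + e)
pad q e ξ = ξ Vec.++ Vec.replicate e (0q q)

module _ (q : ℕ) where
  private instance
    2^q-nonZero : NonZero (2 ^ q)
    2^q-nonZero = m^n≢0 2 q

  toℕ-⟦⟧ : ∀ n → toℕ (⟦ q ⟧ n) ≡ n % 2 ^ q
  toℕ-⟦⟧ n = FinP.toℕ-fromℕ< _

  toℕ-0q : toℕ (0q q) ≡ 0
  toℕ-0q = trans (toℕ-⟦⟧ 0) (m*n%n≡0 0 (2 ^ q))

  mulq-0q : ∀ c → mulq q c (0q q) ≡ 0q q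
  mulq-0q c = cong ⟦ q ⟧ (trans (cong (toℕ c *_) toℕ-0q) (*-zeroʳ (toℕ c)))

  sum-mulq : ∀ c xs → sum (List.map toℕ (List.map (mulq q c) xs)) % 2 ^ q
                      ≡ (toℕ c * sum (List.map toℕ xs)) % 2 ^ q
  sum-mulq c []       = cong (_% 2 ^ q) (sym (*-zeroʳ (toℕ c)))
  sum-mulq c (x ∷ xs) = begin
    (toℕ (mulq q c x) + S′) % m                   ≡⟨ %-distribˡ-+ (toℕ (mulq q c x)) S′ m ⟩
    (toℕ (mulq q c x) % m + S′ % m) % m           ≡⟨ cong₂ (λ u v → (u + v) % m) mulq-% (sum-mulq c xs) ⟩
    ((toℕ c * toℕ x) % m + (toℕ c * S) % m) % m   ≡⟨ %-distribˡ-+ (toℕ c * toℕ x) (toℕ c * S) m ⟨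
    (toℕ c * toℕ x + toℕ c * S) % m               ≡⟨ cong (_% m) (*-distribˡ-+ (toℕ c) (toℕ x) S) ⟨
    (toℕ c * (toℕ x + S)) % m                     ∎
    where
    m  = 2 ^ q
    S  = sum (List.map toℕ xs)
    S′ = sum (List.map toℕ (List.map (mulq q c) xs))
    mulq-% : toℕ (mulq q c x) % m ≡ (toℕ c * toℕ x) % m
    mulq-% = trans (cong (_% m) (toℕ-⟦⟧ _)) (m%n%n≡m%n _ m)

  sumq-scale : ∀ {d} c (ξ : Vec (Zq q) d) → sumq q (scale q c ξ) ≡ mulq q c (sumq q ξ)
  sumq-scale c ξ = FinP.toℕ-injective (begin
    toℕ (sumq q (scale q c ξ))                              ≡⟨ toℕ-⟦⟧ _ ⟩
    sum (List.map toℕ (toList (scale q c ξ))) % m           ≡⟨ cong (λ l → sum (List.map toℕ l) % m) (VecP.toList-map _ ξ) ⟩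
    sum (List.map toℕ (List.map (mulq q c) (toList ξ))) % m ≡⟨ sum-mulq c (toList ξ) ⟩
    (toℕ c * S) % m                                         ≡⟨ *-%-congʳ (toℕ c) S m ⟩
    (toℕ c * (S % m)) % m                                   ≡⟨ cong (λ r → (toℕ c * r) % m) (toℕ-⟦⟧ S) ⟨
    (toℕ c * toℕ (sumq q ξ)) % m                            ≡⟨ toℕ-⟦⟧ _ ⟨
    toℕ (mulq q c (sumq q ξ))                               ∎)
    where
    m = 2 ^ q
    S = sum (List.map toℕ (toList ξ))

  sum-zeros : ∀ e → sum (List.map toℕ (toList (Vec.replicate e (0q q)))) ≡ 0
  sum-zeros zero    = refl
  sum-zeros (suc e) = cong₂ _+_ toℕ-0q (sum-zeros e)

  sumq-pad : ∀ {d} e (ξ : Vec (Zq q) d) → sumq q (pad q e ξ) ≡ sumq q ξ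
  sumq-pad e ξ = cong ⟦ q ⟧ (begin
    sum (List.map toℕ (toList (ξ Vec.++ zeros)))                ≡⟨ cong (sum ∘ List.map toℕ) (VecP.toList-++ ξ zeros) ⟩
    sum (List.map toℕ (toList ξ List.++ toList zeros))          ≡⟨ cong sum (ListP.map-++ toℕ (toList ξ) (toList zeros)) ⟩
    sum (List.map toℕ (toList ξ) List.++ List.map toℕ (toList zeros)) ≡⟨ sum-++ (List.map toℕ (toList ξ)) _ ⟩
    sum (List.map toℕ (toList ξ)) + sum (List.map toℕ (toList zeros)) ≡⟨ cong (_ +_) (sum-zeros e) ⟩
    sum (List.map toℕ (toList ξ)) + 0                           ≡⟨ +-identityʳ _ ⟩
    sum (List.map toℕ (toList ξ))                               ∎)
    where
    zeros = Vec.replicate e (0q q)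

scaledE₁ : (q : ℕ) → Zq q → (d : ℕ) → Vec (Zq q) d
scaledE₁ q a zero    = []
scaledE₁ q a (suc d) = a ∷ Vec.replicate d (0q q)

target≡restrict-scaledE₁ : ∀ {q k d} {a : Zq q} (N : Subset d) → ∣ N ∣ ≡ k →
                           target q k a N ≡ restrict N (scaledE₁ q a d)
target≡restrict-scaledE₁             []          refl = refl
target≡restrict-scaledE₁ {q} {a = a} (true ∷ N)  refl = cong (a ∷_) (sym (restrict-replicate N (0q q)))
target≡restrict-scaledE₁ {q}         (false ∷ N) refl = sym (restrict-replicate N (0q q))

count#⇒IsBlurer : ∀ {k q a d Ξ} → Unique Ξ → k ≤ d → (∀ ξ → ξ ∈ Ξ → sumq q ξ ≡ 0q q) →
  (∀ N → ∣ N ∣ ≡ k → ∀ b → count# q N b Ξ ≡ indicator (target q k a N ≟ₗ b)) → IsBlurer k q a d Ξ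
count#⇒IsBlurer {k} {q} {a} {d} {Ξ} uΞ k≤d zeroSum count#≡ = record
  { isSet    = uΞ
  ; k≤d      = k≤d
  ; zeroSum  = zeroSum
  ; cond1∈N  = λ N ∣N∣≡k first → trans (count#≡ N ∣N∣≡k _) (indicator-true (_ ≟ₗ _) (target-if N first))
  ; cond1∉N  = λ N ∣N∣≡k first → trans (count#≡ N ∣N∣≡k _) (indicator-true (_ ≟ₗ _) (target-if N first))
  ; condRest = λ N ∣N∣≡k b b≢t → trans (count#≡ N ∣N∣≡k _) (indicator-false (_ ≟ₗ _) (b≢t ∘ sym))
  }
  where
  target-if : ∀ N {β} → firstIn N ≡ β →
              target q k a N ≡ (if β then a ∷ replicate (k ∸ 1) (0q q) else replicate k (0q q))
  target-if N = cong (λ β → if β then a ∷ replicate (k ∸ 1) (0q q) else replicate k (0q q))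

count#-length≢ : ∀ {q d b} (N : Subset d) → ∣ N ∣ ≢ length b → (Ξ : List (Vec (Zq q) d)) → count# q N b Ξ ≡ 0
count#-length≢ {b = b} N ∣N∣≢∣b∣ Ξ =
  cong (λ l → length l % 2) (ListP.filter-none ((_≟ₗ b) ∘ restrict N) (All.universal restrict≢b Ξ))
  where
  restrict≢b : ∀ ξ → restrict N ξ ≢ b
  restrict≢b ξ refl = ∣N∣≢∣b∣ (sym (length-restrict N ξ))

module _ {k q : ℕ} {a : Zq q} {d : ℕ} {Ξ : List (Vec (Zq q) d)} (B : IsBlurer k q a d Ξ) where
  open IsBlurer B
  open OddPart (_≟ₗ_ {2 ^ q}) using (count-%2-singleton)

  count#-target : ∀ N → ∣ N ∣ ≡ k → count# q N (target q k a N) Ξ ≡ 1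
  count#-target []          ∣N∣≡k = cond1∉N [] ∣N∣≡k refl
  count#-target (true ∷ N)  ∣N∣≡k = cond1∈N (true ∷ N) ∣N∣≡k refl
  count#-target (false ∷ N) ∣N∣≡k = cond1∉N (false ∷ N) ∣N∣≡k refl

  IsBlurer⇒count# : ∀ N → ∣ N ∣ ≡ k → ∀ b → count# q N b Ξ ≡ indicator (target q k a N ≟ₗ b)
  IsBlurer⇒count# N ∣N∣≡k b with target q k a N ≟ₗ b
  ... | yes refl = count#-target N ∣N∣≡k
  ... | no t≢b with length b ≟ℕ k
  ...   | no ∣b∣≢k = count#-length≢ {q} {d} {b} N (λ ∣N∣≡∣b∣ → ∣b∣≢k (trans (sym ∣N∣≡∣b∣) ∣N∣≡k)) Ξ
  ...   | yes ∣b∣≡k with vecOfLength b ∣b∣≡k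
  ...     | v , refl = condRest N ∣N∣≡k v (t≢b ∘ sym)

  count-restrict-%2 : ∀ N → ∣ N ∣ ≡ k → {Q : List (Zq q) → Set} (Q? : Decidable Q) →
                      count (Q? ∘ restrict N) Ξ % 2 ≡ indicator (Q? (restrict N (scaledE₁ q a d)))
  count-restrict-%2 N ∣N∣≡k Q? = begin
    count (Q? ∘ restrict N) Ξ % 2            ≡⟨ cong (_% 2) (count-map Q? (restrict N) Ξ) ⟨
    count Q? (List.map (restrict N) Ξ) % 2   ≡⟨ count-%2-singleton t (List.map (restrict N) Ξ) parity Q? ⟩
    indicator (Q? t)                         ≡⟨ cong (indicator ∘ Q?) (target≡restrict-scaledE₁ N ∣N∣≡k) ⟩
    indicator (Q? (restrict N (scaledE₁ q a d))) ∎
    where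
    t = target q k a N
    parity : ∀ z → count (_≟ₗ z) (List.map (restrict N) Ξ) % 2 ≡ indicator (t ≟ₗ z)
    parity z = trans (cong (_% 2) (count-map (_≟ₗ z) (restrict N) Ξ)) (IsBlurer⇒count# N ∣N∣≡k z)

  count-restrict-%2-≤ : ∀ N → ∣ N ∣ ≤ k → {Q : List (Zq q) → Set} (Q? : Decidable Q) →
                        count (Q? ∘ restrict N) Ξ % 2 ≡ indicator (Q? (restrict N (scaledE₁ q a d)))
  count-restrict-%2-≤ N ∣N∣≤k Q?
    with enlarge N (k ∸ ∣ N ∣) (subst (_≤ d) (sym (m∸n+n≡m ∣N∣≤k)) k≤d)
  ... | N⁺ , ∣N⁺∣≡ , h , h-restrict = begin
    count (Q? ∘ restrict N) Ξ % 2               ≡⟨ cong (_% 2) (count-∘-cong Q? (sym ∘ h-restrict) Ξ) ⟩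
    count ((Q? ∘ h) ∘ restrict N⁺) Ξ % 2         ≡⟨ count-restrict-%2 N⁺ (trans ∣N⁺∣≡ (m∸n+n≡m ∣N∣≤k)) (Q? ∘ h) ⟩
    indicator (Q? (h (restrict N⁺ e)))          ≡⟨ cong (indicator ∘ Q?) (h-restrict e) ⟩
    indicator (Q? (restrict N e))               ∎
    where
    e = scaledE₁ q a d

IsBlurer-≤ : ∀ {k q a d Ξ} → IsBlurer k q a d Ξ → ∀ k′ → k′ ≤ k → IsBlurer k′ q a d Ξ
IsBlurer-≤ {k} {q} {a} {d} {Ξ} B k′ k′≤k =
  count#⇒IsBlurer isSet (≤-trans k′≤k k≤d) zeroSum λ N ∣N∣≡k′ b → begin
    count# q N b Ξ                               ≡⟨ count-restrict-%2-≤ B N (subst (_≤ k) (sym ∣N∣≡k′) k′≤k) (_≟ₗ b) ⟩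
    indicator (restrict N (scaledE₁ q a d) ≟ₗ b) ≡⟨ cong (indicator ∘ (_≟ₗ b)) (target≡restrict-scaledE₁ N ∣N∣≡k′) ⟨
    indicator (target q k′ a N ≟ₗ b)             ∎
  where open IsBlurer B

restrict-pad : ∀ {q} d {e} (N : Subset (d + e)) (ξ : Vec (Zq q) d) →
  restrict N (pad q e ξ) ≡ restrict (Vec.take d N) ξ List.++ replicate ∣ Vec.drop d N ∣ (0q q)
restrict-pad {q} d N ξ =
  trans (restrict-++ d N ξ _) (cong (restrict (Vec.take d N) ξ List.++_) (restrict-replicate (Vec.drop d N) (0q q)))

replicate-+ : ∀ {A : Set} m n (x : A) → Vec.replicate m x Vec.++ Vec.replicate n x ≡ Vec.replicate (m + n) x
replicate-+ zero    n x = refl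
replicate-+ (suc m) n x = cong (x ∷_) (replicate-+ m n x)

-- For d = 0 the padded vector has no entry a, but then k = 0 and N is empty.
restrict-pad-scaledE₁ : ∀ {q k d e} {a : Zq q} (N : Subset (d + e)) → k ≤ d → ∣ N ∣ ≡ k →
                        restrict N (pad q e (scaledE₁ q a d)) ≡ target q k a N
restrict-pad-scaledE₁ {q} {d = zero} {e} {a} N z≤n ∣N∣≡0 = begin
  restrict N (Vec.replicate e (0q q)) ≡⟨ restrict-replicate N (0q q) ⟩
  replicate ∣ N ∣ (0q q)              ≡⟨ cong (λ n → replicate n (0q q)) ∣N∣≡0 ⟩
  []                                  ≡⟨ cong (λ β → if β then a ∷ [] else []) (∣∣≡0⇒firstIn≡false N ∣N∣≡0) ⟨
  target q 0 a N                      ∎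
restrict-pad-scaledE₁ {q} {d = suc d} {e} {a} N _ ∣N∣≡k =
  trans (cong (restrict N ∘ (a ∷_)) (replicate-+ d e (0q q))) (sym (target≡restrict-scaledE₁ {q} N ∣N∣≡k))

IsBlurer-pad : ∀ {k q a d Ξ} → IsBlurer k q a d Ξ → (e : ℕ) → IsBlurer k q a (d + e) (List.map (pad q e) Ξ)
IsBlurer-pad {k} {q} {a} {d} {Ξ} B e =
  count#⇒IsBlurer (Unique.map⁺ (VecP.++-injectiveˡ _ _) isSet) (≤-trans k≤d (m≤m+n d e)) zeroSum′ count#≡
  where
  open IsBlurer B

  zeroSum′ : ∀ ζ → ζ ∈ List.map (pad q e) Ξ → sumq q ζ ≡ 0q q
  zeroSum′ ζ ζ∈ with ∈-map⁻ (pad q e) ζ∈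
  ... | ξ , ξ∈Ξ , refl = trans (sumq-pad q e ξ) (zeroSum ξ ξ∈Ξ)

  count#≡ : ∀ N → ∣ N ∣ ≡ k → ∀ b → count# q N b (List.map (pad q e) Ξ) ≡ indicator (target q k a N ≟ₗ b)
  count#≡ N ∣N∣≡k b = begin
    count ((_≟ₗ b) ∘ restrict N) (List.map (pad q e) Ξ) % 2  ≡⟨ cong (_% 2) (count-map ((_≟ₗ b) ∘ restrict N) (pad q e) Ξ) ⟩
    count ((_≟ₗ b) ∘ restrict N ∘ pad q e) Ξ % 2             ≡⟨ cong (_% 2) (count-∘-cong (_≟ₗ b) (restrict-pad {q} d N) Ξ) ⟩
    count (Q? ∘ restrict N₁) Ξ % 2                           ≡⟨ count-restrict-%2-≤ B N₁ ∣N₁∣≤k Q? ⟩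
    indicator (Q? (restrict N₁ (scaledE₁ q a d)))            ≡⟨ cong (indicator ∘ (_≟ₗ b)) (restrict-pad {q} d N _) ⟨
    indicator (restrict N (pad q e (scaledE₁ q a d)) ≟ₗ b)   ≡⟨ cong (indicator ∘ (_≟ₗ b)) (restrict-pad-scaledE₁ {q} N k≤d ∣N∣≡k) ⟩
    indicator (target q k a N ≟ₗ b)                          ∎
    where
    N₁ = Vec.take d N
    ∣N₁∣≤k = ≤-trans (∣take∣≤∣∣ d N) (≤-reflexive ∣N∣≡k)
    Q? : Decidable (λ l → l List.++ replicate ∣ Vec.drop d N ∣ (0q q) ≡ b)
    Q? l = (l List.++ replicate ∣ Vec.drop d N ∣ (0q q)) ≟ₗ b

scale-scaledE₁ : ∀ q (c a : Zq q) d → scale q c (scaledE₁ q a d) ≡ scaledE₁ q (mulq q c a) d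
scale-scaledE₁ q c a zero    = refl
scale-scaledE₁ q c a (suc d) =
  cong (mulq q c a ∷_) (trans (VecP.map-replicate (mulq q c) (0q q) d) (cong (Vec.replicate d) (mulq-0q q c)))

module _ {q d : ℕ} where
  _≟ᵥ_ : DecidableEquality (Vec (Zq q) d)
  _≟ᵥ_ = VecP.≡-dec FinP._≟_

  open OddPart _≟ᵥ_ using (oddPart; oddPart-Unique; ∈-oddPart⁻; count-oddPart)

  IsBlurer-scale : ∀ {k a Ξ} → IsBlurer k q a d Ξ → (c : Zq q) →
                   IsBlurer k q (mulq q c a) d (oddPart (List.map (scale q c) Ξ))
  IsBlurer-scale {k} {a} {Ξ} B c = count#⇒IsBlurer (oddPart-Unique cΞ) k≤d zeroSum′ count#≡
    where
    open IsBlurer B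
    cΞ = List.map (scale q c) Ξ

    zeroSum′ : ∀ ζ → ζ ∈ oddPart cΞ → sumq q ζ ≡ 0q q
    zeroSum′ ζ ζ∈ with ∈-map⁻ (scale q c) (∈-oddPart⁻ cΞ ζ∈)
    ... | ξ , ξ∈Ξ , refl = trans (sumq-scale q c ξ) (trans (cong (mulq q c) (zeroSum ξ ξ∈Ξ)) (mulq-0q q c))

    count#≡ : ∀ N → ∣ N ∣ ≡ k → ∀ b → count# q N b (oddPart cΞ) ≡ indicator (target q k (mulq q c a) N ≟ₗ b)
    count#≡ N ∣N∣≡k b = begin
      count ((_≟ₗ b) ∘ restrict N) (oddPart cΞ) % 2     ≡⟨ count-oddPart ((_≟ₗ b) ∘ restrict N) cΞ ⟩
      count ((_≟ₗ b) ∘ restrict N) cΞ % 2               ≡⟨ cong (_% 2) (count-map ((_≟ₗ b) ∘ restrict N) (scale q c) Ξ) ⟩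
      count ((_≟ₗ b) ∘ restrict N ∘ scale q c) Ξ % 2    ≡⟨ cong (_% 2) (count-∘-cong (_≟ₗ b) (restrict-map (mulq q c) N) Ξ) ⟩
      count (Q? ∘ restrict N) Ξ % 2                     ≡⟨ count-restrict-%2 B N ∣N∣≡k Q? ⟩
      indicator (Q? (restrict N e))                     ≡⟨ cong (indicator ∘ (_≟ₗ b)) (restrict-map (mulq q c) N e) ⟨
      indicator (restrict N (scale q c e) ≟ₗ b)         ≡⟨ cong (λ v → indicator (restrict N v ≟ₗ b)) (scale-scaledE₁ q c a d) ⟩
      indicator (restrict N (scaledE₁ q (mulq q c a) d) ≟ₗ b) ≡⟨ cong (indicator ∘ (_≟ₗ b)) (target≡restrict-scaledE₁ {q} N ∣N∣≡k) ⟨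
      indicator (target q k (mulq q c a) N ≟ₗ b)        ∎
      where
      e = scaledE₁ q a d
      Q? : Decidable (λ l → List.map (mulq q c) l ≡ b)
      Q? l = List.map (mulq q c) l ≟ₗ b

mainTheorem9 : (k q : ℕ) (a : Zq q) (d : ℕ) (Ξ : List (Vec (Zq q) d)) →
    IsBlurer k q a d Ξ →
      ((d′ : ℕ) → d ≤ d′ → Σ (List (Vec (Zq q) d′)) (λ Ξ′ → IsBlurer k q a d′ Ξ′))
    × ((k′ : ℕ) → k′ ≤ k → IsBlurer k′ q a d Ξ)
    × ((c : Zq q) → Σ (List (Vec (Zq q) d)) (λ Ξ′ → IsBlurer k q (mulq q c a) d Ξ′))
mainTheorem9 k q a d Ξ B = larger-d , IsBlurer-≤ B , λ c → _ , IsBlurer-scale B c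
  where
  larger-d : (d′ : ℕ) → d ≤ d′ → Σ (List (Vec (Zq q) d′)) (λ Ξ′ → IsBlurer k q a d′ Ξ′)
  larger-d d′ d≤d′ with m≤n⇒∃[o]m+o≡n d≤d′
  ... | e , refl = _ , IsBlurer-pad B e
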